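{- For integers $1\le k\le n$, there is a $[k,d,n]$ PSF family with $d=\lfloor\log_2\binom{n}{k}\rfloor$.
   Context: An ordered set is a finite sequence of distinct elements of a ground set. A family $\mathcal F$ of ordered sets is prefix set-free (PSF) if for any two distinct members $A,B\in\mathcal F$, no prefix of $A$ equals $B$ as an (unordered) set. If the ground set has $n$ elements, every member of $\mathcal F$ has length at least $k$, and $|\mathcal F|\ge 2^d$, then $\mathcal F$ is called a $[k,d,n]$ PSF family. -}

module Defs where

open import Data.Nat using (ℕ; _≤_; _^_)
open import Data.Fin using (Fin)
open import Data.List using (List; length; take)
open import Data.List.Membership.Propositional using (_∈_)
open import Data.List.Relation.Unary.All using (All)
open import Data.List.Relation.Unary.Unique.Propositional using (Unique)
open import Relation.Binary.PropositionalEquality using (_≡_)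
open import Relation.Nullary using (¬_)
open import Data.Product using (_×_)
open import Function.Bundles using (_⇔_)

OrderedSet : ℕ → Set
OrderedSet n = List (Fin n)

IsOrderedSet : ∀ {n} → OrderedSet n → Set
IsOrderedSet A = Unique A

SameSet : ∀ {n} → List (Fin n) → List (Fin n) → Set
SameSet P B = ∀ x → (x ∈ P) ⇔ (x ∈ B)

PrefixSetFree : ∀ {n} → List (OrderedSet n) → Set
PrefixSetFree {n} F =
  ∀ (A B : OrderedSet n) → A ∈ F → B ∈ F → ¬ (A ≡ B) →
  ∀ (m : ℕ) → ¬ SameSet (take m A) B

IsPSF : (k d n : ℕ) → List (OrderedSet n) → Set
IsPSF k d n F =
  Unique F × All IsOrderedSet F × PrefixSetFree F ×
  All (λ A → k ≤ length A) F × (2 ^ d ≤ length F)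

-- Take all k-subsets of Fin n, each listed in increasing order: n C k ordered
-- sets of length k. A prefix of A is contained in A, so if it has the same
-- elements as another member B, then B ⊆ A with |B| = |A|, hence A and B are the
-- same subset and, being listed in the same canonical order, the same list.
module Submission where

open import Defs
open import Data.Nat using (ℕ; _≤_)
open import Data.Nat.Logarithm using (⌊log₂_⌋)
open import Data.Nat.Combinatorics using (_C_)
open import Data.List using (List)
open import Data.Product using (Σ)

open import Data.Nat using (zero; suc; _+_; _*_; _^_; _∸_; z≤n; s≤s; ⌊_/2⌋; ⌈_/2⌉)
open import Data.Nat.Properties
  using ( ≤-refl; ≤-reflexive; module ≤-Reasoning; +-identityʳ; +-monoʳ-≤; *-monoʳ-≤
        ; m≤m+n; m≤n⇒m≤1+n; <⇒≢; ⌊n/2⌋≤⌈n/2⌉; ⌊n/2⌋+⌈n/2⌉≡n )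
open import Data.Nat.Logarithm using (⌊log₂⌊n/2⌋⌋≡⌊log₂n⌋∸1)
open import Data.Nat.Combinatorics using (nCk+nC[k+1]≡[n+1]C[k+1])
open import Data.Fin using (Fin) renaming (zero to fzero; suc to fsuc)
open import Data.Fin.Properties using (suc-injective)
open import Data.List using ([]; _∷_; [_]; map; _++_; length; take)
open import Data.List.Properties using (length-map; length-++; map-injective; ∷-injectiveʳ)
open import Data.List.Membership.Propositional using (_∈_)
open import Data.List.Membership.Propositional.Properties using (∈-map⁻; ∈-map⁺; ∈-++⁻)
open import Data.List.Relation.Unary.Any using (here; there)
open import Data.List.Relation.Unary.All as All using ([])
open import Data.List.Relation.Unary.AllPairs using ([]; _∷_)
open import Data.List.Relation.Unary.Unique.Propositional using (Unique)
import Data.List.Relation.Unary.Unique.Propositional.Properties as Unique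
open import Data.List.Relation.Binary.Disjoint.Propositional using (Disjoint)
open import Data.List.Relation.Binary.Subset.Propositional using (_⊆_)
import Data.List.Relation.Binary.Sublist.Propositional as Sublist
open import Data.List.Relation.Binary.Sublist.Propositional.Properties using (take-⊆)
open import Data.Product using (_,_)
open import Data.Sum using (inj₁; inj₂)
open import Data.Empty using (⊥; ⊥-elim)
open import Relation.Binary.PropositionalEquality
  using (_≡_; refl; sym; trans; cong; cong₂; subst; module ≡-Reasoning)
open import Function.Base using (_∘_)
open import Function.Bundles using (Equivalence)

2*⌊n/2⌋≤n : ∀ n → 2 * ⌊ n /2⌋ ≤ n
2*⌊n/2⌋≤n n = begin
  ⌊ n /2⌋ + (⌊ n /2⌋ + 0) ≡⟨ cong (⌊ n /2⌋ +_) (+-identityʳ ⌊ n /2⌋) ⟩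
  ⌊ n /2⌋ + ⌊ n /2⌋       ≤⟨ +-monoʳ-≤ ⌊ n /2⌋ (⌊n/2⌋≤⌈n/2⌉ n) ⟩
  ⌊ n /2⌋ + ⌈ n /2⌉       ≡⟨ ⌊n/2⌋+⌈n/2⌉≡n n ⟩
  n                       ∎
  where open ≤-Reasoning

2^⌊log₂n⌋≤n : ∀ n → 1 ≤ n → 2 ^ ⌊log₂ n ⌋ ≤ n
2^⌊log₂n⌋≤n n = 2^L≤n ⌊log₂ n ⌋ n refl
  where
  -- Induction on the logarithm L rather than on n, since ⌊log₂ ⌊n/2⌋⌋ ≡ L ∸ 1.
  2^L≤n : ∀ L n → ⌊log₂ n ⌋ ≡ L → 1 ≤ n → 2 ^ L ≤ n
  2^L≤n zero          n             _    1≤n = 1≤n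
  2^L≤n (suc L)       zero          _    ()
  2^L≤n (suc L)       (suc zero)    ()   _
  2^L≤n (suc L)       (suc (suc m)) log≡ _   = begin
    2 * 2 ^ L                ≤⟨ *-monoʳ-≤ 2 (2^L≤n L ⌊ suc (suc m) /2⌋ log⌊n/2⌋≡L (s≤s z≤n)) ⟩
    2 * ⌊ suc (suc m) /2⌋    ≤⟨ 2*⌊n/2⌋≤n (suc (suc m)) ⟩
    suc (suc m)              ∎
    where
    open ≤-Reasoning
    log⌊n/2⌋≡L : ⌊log₂ ⌊ suc (suc m) /2⌋ ⌋ ≡ L
    log⌊n/2⌋≡L = trans (⌊log₂⌊n/2⌋⌋≡⌊log₂n⌋∸1 (suc (suc m))) (cong (_∸ 1) log≡)

1≤nCk : ∀ n k → k ≤ n → 1 ≤ n C k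
1≤nCk n       zero    _         = ≤-refl
1≤nCk (suc n) (suc k) (s≤s k≤n) = begin
  1                    ≤⟨ 1≤nCk n k k≤n ⟩
  n C k                ≤⟨ m≤m+n (n C k) (n C suc k) ⟩
  n C k + n C suc k    ≡⟨ nCk+nC[k+1]≡[n+1]C[k+1] n k ⟩
  suc n C suc k        ∎
  where open ≤-Reasoning

subsets : (n k : ℕ) → List (List (Fin n))
subsets n       zero    = [ [] ]
subsets zero    (suc k) = []
subsets (suc n) (suc k) =
  map (λ A → fzero ∷ map fsuc A) (subsets n k) ++ map (map fsuc) (subsets n (suc k))

length-subsets : ∀ n k → length (subsets n k) ≡ n C k
length-subsets n       zero    = refl
length-subsets zero    (suc k) = refl
length-subsets (suc n) (suc k) = begin
  length (map _ (subsets n k) ++ map _ (subsets n (suc k)))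
    ≡⟨ length-++ (map _ (subsets n k)) ⟩
  length (map _ (subsets n k)) + length (map _ (subsets n (suc k)))
    ≡⟨ cong₂ _+_ (length-map _ (subsets n k)) (length-map _ (subsets n (suc k))) ⟩
  length (subsets n k) + length (subsets n (suc k))
    ≡⟨ cong₂ _+_ (length-subsets n k) (length-subsets n (suc k)) ⟩
  n C k + n C suc k
    ≡⟨ nCk+nC[k+1]≡[n+1]C[k+1] n k ⟩
  suc n C suc k ∎
  where open ≡-Reasoning

data SubsetsSucView (n k : ℕ) : List (Fin (suc n)) → Set where
  with-zero    : ∀ {A} → A ∈ subsets n k       → SubsetsSucView n k (fzero ∷ map fsuc A)
  without-zero : ∀ {A} → A ∈ subsets n (suc k) → SubsetsSucView n k (map fsuc A)

subsets-view : ∀ {n k A} → A ∈ subsets (suc n) (suc k) → SubsetsSucView n k A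
subsets-view {n} {k} A∈ with ∈-++⁻ (map (λ A → fzero ∷ map fsuc A) (subsets n k)) A∈
... | inj₁ A∈₀ with ∈-map⁻ _ A∈₀
...   | _ , A′∈ , refl = with-zero A′∈
subsets-view {n} {k} A∈ | inj₂ A∈₁ with ∈-map⁻ _ A∈₁
...   | _ , A′∈ , refl = without-zero A′∈

∈-subsets⇒length≡ : ∀ n k {A} → A ∈ subsets n k → length A ≡ k
∈-subsets⇒length≡ n       zero    (here refl) = refl
∈-subsets⇒length≡ (suc n) (suc k) A∈ with subsets-view A∈
... | with-zero    {A} A∈′ = cong suc (trans (length-map fsuc A) (∈-subsets⇒length≡ n k A∈′))
... | without-zero {A} A∈′ = trans (length-map fsuc A) (∈-subsets⇒length≡ n (suc k) A∈′)

fzero∉map-fsuc : ∀ {n} {A : List (Fin n)} → fzero ∈ map fsuc A → ⊥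
fzero∉map-fsuc z∈ with ∈-map⁻ fsuc z∈
... | _ , _ , ()

∈-map-fsuc⁻ : ∀ {n} {x : Fin n} {A} → fsuc x ∈ map fsuc A → x ∈ A
∈-map-fsuc⁻ x∈ with ∈-map⁻ fsuc x∈
... | _ , x∈A , refl = x∈A

∈-subsets⇒Unique : ∀ n k {A} → A ∈ subsets n k → Unique A
∈-subsets⇒Unique n       zero    (here refl) = []
∈-subsets⇒Unique (suc n) (suc k) A∈ with subsets-view A∈
... | with-zero    A∈′ =
  All.tabulate (λ x∈ z≡x → fzero∉map-fsuc (subst (_∈ _) (sym z≡x) x∈))
    ∷ Unique.map⁺ suc-injective (∈-subsets⇒Unique n k A∈′)
... | without-zero A∈′ = Unique.map⁺ suc-injective (∈-subsets⇒Unique n (suc k) A∈′)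

subsets-Unique : ∀ n k → Unique (subsets n k)
subsets-Unique n       zero    = [] ∷ []
subsets-Unique zero    (suc k) = []
subsets-Unique (suc n) (suc k) =
  Unique.++⁺ (Unique.map⁺ (map-injective suc-injective ∘ ∷-injectiveʳ) (subsets-Unique n k))
             (Unique.map⁺ (map-injective suc-injective) (subsets-Unique n (suc k)))
             zero-free-disjoint
  where
  zero-free-disjoint : Disjoint (map (λ A → fzero ∷ map fsuc A) (subsets n k))
                                (map (map fsuc) (subsets n (suc k)))
  zero-free-disjoint (A∈₀ , A∈₁) with ∈-map⁻ _ A∈₀ | ∈-map⁻ _ A∈₁
  ... | _ , _ , refl | _ , _ , eq = fzero∉map-fsuc (subst (fzero ∈_) eq (here refl))

-- Sizes k ≤ j rather than k ≡ j: when only A contains zero, the recursive call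
-- compares sizes k and suc j (and then contradicts it by lengths).
⊆-subsets⇒≡ : ∀ n k j {A B} → A ∈ subsets n k → B ∈ subsets n j → k ≤ j → B ⊆ A → A ≡ B
⊆-subsets⇒≡ n       zero    j       {B = []}    (here refl) _  _ _   = refl
⊆-subsets⇒≡ n       zero    j       {B = _ ∷ _} (here refl) _  _ B⊆A with B⊆A (here refl)
... | ()
⊆-subsets⇒≡ (suc n) (suc k) (suc j) A∈ B∈ (s≤s k≤j) B⊆A with subsets-view A∈ | subsets-view B∈
... | with-zero A∈′ | with-zero B∈′ =
  cong (λ A → fzero ∷ map fsuc A) (⊆-subsets⇒≡ n k j A∈′ B∈′ k≤j B′⊆A′)
  where
  B′⊆A′ : _ ⊆ _
  B′⊆A′ x∈ with B⊆A (there (∈-map⁺ fsuc x∈))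
  ... | there x∈A = ∈-map-fsuc⁻ x∈A
... | with-zero A∈′ | without-zero B∈′ = ⊥-elim (<⇒≢ (s≤s k≤j) k≡1+j)
  where
  B′⊆A′ : _ ⊆ _
  B′⊆A′ x∈ with B⊆A (∈-map⁺ fsuc x∈)
  ... | there x∈A = ∈-map-fsuc⁻ x∈A
  k≡1+j : k ≡ suc j
  k≡1+j = trans (sym (∈-subsets⇒length≡ n k A∈′))
    (trans (cong length (⊆-subsets⇒≡ n k (suc j) A∈′ B∈′ (m≤n⇒m≤1+n k≤j) B′⊆A′))
           (∈-subsets⇒length≡ n (suc j) B∈′))
... | without-zero _ | with-zero _ = ⊥-elim (fzero∉map-fsuc (B⊆A (here refl)))
... | without-zero A∈′ | without-zero B∈′ =
  cong (map fsuc) (⊆-subsets⇒≡ n (suc k) (suc j) A∈′ B∈′ (s≤s k≤j)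
                    (λ x∈ → ∈-map-fsuc⁻ (B⊆A (∈-map⁺ fsuc x∈))))

take⊆ : ∀ {A : Set} m (xs : List A) → take m xs ⊆ xs
take⊆ m xs = Sublist.lookup (take-⊆ m xs)

subsets-PrefixSetFree : ∀ n k → PrefixSetFree (subsets n k)
subsets-PrefixSetFree n k A B A∈ B∈ A≢B m prefix≈B =
  A≢B (⊆-subsets⇒≡ n k k A∈ B∈ ≤-refl (λ x∈B → take⊆ m A (Equivalence.from (prefix≈B _) x∈B)))

claim5 : ∀ (k n : ℕ) → 1 ≤ k → k ≤ n →
    Σ (List (OrderedSet n)) (λ F → IsPSF k ⌊log₂ (n C k) ⌋ n F)
claim5 k n _ k≤n = subsets n k
  , subsets-Unique n k
  , All.tabulate (∈-subsets⇒Unique n k)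
  , subsets-PrefixSetFree n k
  , All.tabulate (λ A∈ → ≤-reflexive (sym (∈-subsets⇒length≡ n k A∈)))
  , subst (2 ^ ⌊log₂ (n C k) ⌋ ≤_) (sym (length-subsets n k))
      (2^⌊log₂n⌋≤n (n C k) (1≤nCk n k k≤n))
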